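{- Let $n\in\mathbb{N}$. Two points $A,B\in\mathbb{Q}\cup\{\infty\}$ are neighbours in both the Farey tessellation $\mathcal{F}$ and the scaled tessellation $\frac{1}{n}\mathcal{F}$ if and only if they have reduced forms $A=\frac{a}{n_1c_1}$ and $B=\frac{b}{n_2d_1}$ with $n=n_1n_2$ (for positive integers $n_1,n_2$) and $|an_2d_1-bn_1c_1|=1$.
   Context: Work in the upper half-plane with $\infty=\frac{1}{0}$. The Farey tessellation $\mathcal{F}$ is the ideal triangulation with vertex set $\mathbb{Q}\cup\{\infty\}$ in which two vertices with reduced forms $\frac{p}{q},\frac{r}{s}$ are joined by a geodesic edge (are neighbours in $\mathcal{F}$) iff $|ps-qr|=1$. $\frac{1}{n}\mathcal{F}$ is the image of $\mathcal{F}$ under the map $z\mapsto z/n$; thus $A,B$ are neighbours in $\frac{1}{n}\mathcal{F}$ iff $nA,nB$ are neighbours in $\mathcal{F}$. -}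

module Defs where

open import Data.Nat using (ℕ; suc)
open import Data.Nat.Coprimality using (Coprime)
open import Data.Integer using (ℤ; +_; _*_; _-_; ∣_∣)
open import Data.Rational using (ℚ; ↥_; ↧_) renaming (_*_ to _*ℚ_)
open import Data.Rational using (_/_)
open import Data.Product using (Σ; ∃; _×_)
open import Relation.Binary.PropositionalEquality using (_≡_; _≢_)

data Point : Set where
  fin : ℚ → Point
  ∞   : Point

Represents : Point → ℤ → ℤ → Set
Represents (fin x) p q = (q ≢ + 0) × (p * (↧ x) ≡ (↥ x) * q)
Represents ∞       p q = q ≡ + 0

-- p/q is a reduced form of A: gcd(p,q) = 1 and p/q = A  (∞ = ±1/0)
ReducedForm : Point → ℤ → ℤ → Set
ReducedForm A p q = Coprime ∣ p ∣ ∣ q ∣ × Represents A p q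

FareyNeighbours : Point → Point → Set
FareyNeighbours A B =
  ∃ λ p → ∃ λ q → ∃ λ r → ∃ λ s →
    ReducedForm A p q × ReducedForm B r s × ∣ p * s - q * r ∣ ≡ 1

scale : (n : ℕ) → Point → Point
scale n (fin x) = fin ((+ n / 1) *ℚ x)
scale n ∞       = ∞

-- Neighbours in (1/n)F : nA, nB are neighbours in F
ScaledFareyNeighbours : ℕ → Point → Point → Set
ScaledFareyNeighbours n A B = FareyNeighbours (scale n A) (scale n B)

{-# OPTIONS --safe #-}
-- If A = p/q and nA = p′/q′ are reduced, then q′ divides q, say q = k q′ with p′ k = n p,
-- and likewise s = m s′, r′ m = n r for B = r/s and nB = r′/s′. Multiplying the determinant
-- of the scaled pair by k m gives n times the determinant of the original pair, so the two
-- unit determinants force n = |k| |m|, and n₁ = |k|, n₂ = |m| is the factorisation.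
-- Conversely, scaling a/(n₁c₁) and b/(n₂d₁) by n₁n₂ gives n₂a/c₁ and n₁b/d₁, whose determinant
-- is the given one; a unit determinant also makes both fractions reduced.
module Submission where

open import Defs
open import Data.Nat using (ℕ; _≥_; _*_)
open import Data.Integer using (ℤ; +_; ∣_∣; _-_; NonZero) renaming (_*_ to _*ℤ_)
open import Data.Product using (∃; _×_; _,_; proj₁; proj₂)
open import Function.Bundles using (_⇔_; mk⇔)
open import Relation.Binary.PropositionalEquality
  using (_≡_; _≢_; refl; sym; trans; cong; cong₂; subst; module ≡-Reasoning)

import Data.Nat.Base as ℕ
import Data.Nat.Properties as ℕP
import Data.Nat.Divisibility as ℕD
import Data.Nat.Coprimality as ℕC
import Data.Integer as ℤ
import Data.Integer.Properties as ℤP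
import Data.Integer.Coprimality as ℤC
import Data.Integer.Divisibility.Signed as ℤD
open import Data.Integer.Tactic.RingSolver using (solve-∀)
open import Data.Rational as ℚ using (↥_; ↧_)
import Data.Rational.Properties as ℚP

cross-trans : ∀ p q r s t u .{{_ : NonZero s}} →
              p *ℤ s ≡ r *ℤ q → r *ℤ u ≡ t *ℤ s → p *ℤ u ≡ t *ℤ q
cross-trans p q r s t u ps≡rq ru≡ts = ℤP.*-cancelʳ-≡ _ _ s (begin
  p *ℤ u *ℤ s    ≡⟨ swap p u s ⟩
  p *ℤ s *ℤ u    ≡⟨ cong (_*ℤ u) ps≡rq ⟩
  r *ℤ q *ℤ u    ≡⟨ swap r q u ⟩
  r *ℤ u *ℤ q    ≡⟨ cong (_*ℤ q) ru≡ts ⟩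
  t *ℤ s *ℤ q    ≡⟨ swap t s q ⟩
  t *ℤ q *ℤ s    ∎)
  where
  open ≡-Reasoning
  swap : ∀ a b c → a *ℤ b *ℤ c ≡ a *ℤ c *ℤ b
  swap = solve-∀

represents⇒cross : ∀ {x p q p′ q′} → Represents (fin x) p q → Represents (fin x) p′ q′ →
                   p *ℤ q′ ≡ p′ *ℤ q
represents⇒cross {x} {p} {q} {p′} {q′} (_ , p↧x≡↥xq) (_ , p′↧x≡↥xq′) =
  cross-trans p q (↥ x) (↧ x) p′ q′ p↧x≡↥xq (sym p′↧x≡↥xq′)

cross⇒represents : ∀ {x p q p′ q′} → Represents (fin x) p q → q′ ≢ + 0 →
                   p *ℤ q′ ≡ p′ *ℤ q → Represents (fin x) p′ q′
cross⇒represents {x} {p} {q} {p′} {q′} (q≢0 , p↧x≡↥xq) q′≢0 pq′≡p′q =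
  q′≢0 , cross-trans p′ q′ p q (↥ x) (↧ x) {{ℤ.≢-nonZero q≢0}} (sym pq′≡p′q) p↧x≡↥xq

represents-* : ∀ w x → Represents (fin (w ℚ.* x)) (↥ w *ℤ ↥ x) (↧ w *ℤ ↧ x)
represents-* w x = (λ ()) , (begin
  ↥ w *ℤ ↥ x *ℤ ↧ y           ≡⟨ cong (_*ℤ ↧ y) (ℚP.↥-* w x) ⟨
  ↥ y *ℤ _ *ℤ ↧ y             ≡⟨ swap (↥ y) _ (↧ y) ⟩
  ↥ y *ℤ (↧ y *ℤ _)           ≡⟨ cong (↥ y *ℤ_) (ℚP.↧-* w x) ⟩
  ↥ y *ℤ (↧ w *ℤ ↧ x)         ∎)
  where
  open ≡-Reasoning
  y = w ℚ.* x
  swap : ∀ a b c → a *ℤ b *ℤ c ≡ a *ℤ (c *ℤ b)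
  swap = solve-∀

represents-scale : ∀ n {A p q} → Represents A p q → Represents (scale n A) (+ n *ℤ p) q
represents-scale n {∞}     q≡0 = q≡0
represents-scale n {fin x} {p} {q} (q≢0 , p↧x≡↥xq) =
  cross⇒represents {w ℚ.* x} {↥ w *ℤ ↥ x} {↧ w *ℤ ↧ x} {+ n *ℤ p} {q}
    (represents-* w x) q≢0 (begin
    ↥ w *ℤ ↥ x *ℤ q          ≡⟨ cong (λ i → i *ℤ ↥ x *ℤ q) (cong ↥_ w≡n) ⟩
    + n *ℤ ↥ x *ℤ q          ≡⟨ ℤP.*-assoc (+ n) (↥ x) q ⟩
    + n *ℤ (↥ x *ℤ q)        ≡⟨ cong (+ n *ℤ_) p↧x≡↥xq ⟨
    + n *ℤ (p *ℤ ↧ x)        ≡⟨ ℤP.*-assoc (+ n) p (↧ x) ⟨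
    + n *ℤ p *ℤ ↧ x          ≡⟨ cong (+ n *ℤ p *ℤ_) (ℤP.*-identityˡ (↧ x)) ⟨
    + n *ℤ p *ℤ (+ 1 *ℤ ↧ x) ≡⟨ cong (λ i → + n *ℤ p *ℤ (i *ℤ ↧ x)) (cong ↧_ w≡n) ⟨
    + n *ℤ p *ℤ (↧ w *ℤ ↧ x) ∎)
  where
  open ≡-Reasoning
  w = + n ℚ./ 1
  w≡n : w ≡ ℚ.mkℚ (+ n) 0 (ℕC.sym (ℕC.1-coprimeTo n))
  w≡n = ℚP.normalize-coprime (ℕC.sym (ℕC.1-coprimeTo n))

represents-cancel : ∀ k {A p q} .{{_ : NonZero k}} →
                    Represents A (k *ℤ p) (k *ℤ q) → Represents A p q
represents-cancel k {∞}     {q = q} kq≡0 =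
  ℤP.*-cancelˡ-≡ k q (+ 0) (trans kq≡0 (sym (ℤP.*-zeroʳ k)))
represents-cancel k {fin x} {p} {q} r@(kq≢0 , _) =
  cross⇒represents {x} {k *ℤ p} {k *ℤ q} {p} {q} r q≢0 (swap k p q)
  where
  q≢0 : q ≢ + 0
  q≢0 q≡0 = kq≢0 (trans (cong (k *ℤ_) q≡0) (ℤP.*-zeroʳ k))
  swap : ∀ a b c → a *ℤ b *ℤ c ≡ b *ℤ (a *ℤ c)
  swap = solve-∀

represents-unscale : ∀ n₁ n₂ {A p q} → n₁ ≥ 1 →
                     Represents A p (+ n₁ *ℤ q) → Represents (scale (n₁ * n₂) A) (+ n₂ *ℤ p) q
represents-unscale n₁ n₂ {A} {p} {q} n₁≥1 rep =
  represents-cancel (+ n₁) {{ℕ.>-nonZero n₁≥1}}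
    (subst (λ i → Represents (scale (n₁ * n₂) A) i (+ n₁ *ℤ q)) n₁n₂p≡n₁[n₂p]
      (represents-scale (n₁ * n₂) rep))
  where
  n₁n₂p≡n₁[n₂p] : + (n₁ * n₂) *ℤ p ≡ + n₁ *ℤ (+ n₂ *ℤ p)
  n₁n₂p≡n₁[n₂p] = trans (cong (_*ℤ p) (ℤP.pos-* n₁ n₂)) (ℤP.*-assoc (+ n₁) (+ n₂) p)

det-coprime : ∀ p q r s → ∣ p *ℤ s - q *ℤ r ∣ ≡ 1 → ℤC.Coprime p q × ℤC.Coprime r s
det-coprime p q r s det =
  (λ (i∣p , i∣q) → divides-det (ℤD.∣m⇒∣m*n s (ℤD.∣ᵤ⇒∣ {i = p} i∣p))
                                (ℤD.∣m⇒∣m*n r (ℤD.∣ᵤ⇒∣ {i = q} i∣q))) ,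
  (λ (i∣r , i∣s) → divides-det (ℤD.∣n⇒∣m*n p (ℤD.∣ᵤ⇒∣ {i = s} i∣s))
                                (ℤD.∣n⇒∣m*n q (ℤD.∣ᵤ⇒∣ {i = r} i∣r)))
  where
  divides-det : ∀ {i} → + i ℤD.∣ p *ℤ s → + i ℤD.∣ q *ℤ r → i ≡ 1
  divides-det i∣ps i∣qr = ℕD.∣1⇒≡1 (subst (_ ℕD.∣_) det (ℤD.∣⇒∣ᵤ (ℤD.∣m∣n⇒∣m-n i∣ps i∣qr)))

denominator-divides : ∀ n {x p q p′ q′} → Represents (fin x) p q →
                      ReducedForm (scale n (fin x)) p′ q′ →
                      ∃ λ k → q ≡ k *ℤ q′ × p′ *ℤ k ≡ + n *ℤ p
denominator-divides n {x} {p} {q} {p′} {q′} rep (coprime , rep′@(q′≢0 , _)) =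
  k , q≡kq′ , ℤP.*-cancelʳ-≡ _ _ q′ {{ℤ.≢-nonZero q′≢0}} (begin
    p′ *ℤ k *ℤ q′   ≡⟨ ℤP.*-assoc p′ k q′ ⟩
    p′ *ℤ (k *ℤ q′) ≡⟨ cong (p′ *ℤ_) q≡kq′ ⟨
    p′ *ℤ q         ≡⟨ npq′≡p′q ⟨
    + n *ℤ p *ℤ q′  ∎)
  where
  open ≡-Reasoning
  npq′≡p′q : + n *ℤ p *ℤ q′ ≡ p′ *ℤ q
  npq′≡p′q = represents⇒cross {+ n ℚ./ 1 ℚ.* x} {+ n *ℤ p} {q} {p′} {q′}
               (represents-scale n rep) rep′
  q′∣q : q′ ℤD.∣ q
  q′∣q = ℤD.∣ᵤ⇒∣ (ℤC.coprime-divisor q′ p′ q (ℤC.sym {p′} {q′} coprime)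
                   (ℤD.∣⇒∣ᵤ (ℤD.divides (+ n *ℤ p) (sym npq′≡p′q))))
  open ℤD._∣_ q′∣q renaming (quotient to k; equality to q≡kq′)

abs-factor : ∀ k q → ∃ λ c → k *ℤ q ≡ + ∣ k ∣ *ℤ c
abs-factor (+ m)     q = q , refl
abs-factor ℤ.-[1+ m ] q = ℤ.- q , neg-swap (+ ℕ.suc m) q
  where
  neg-swap : ∀ a b → ℤ.- a *ℤ b ≡ a *ℤ ℤ.- b
  neg-swap = solve-∀

scale-factor : ∀ n p r p′ q′ r′ s′ k m {q s} → p′ *ℤ k ≡ + n *ℤ p → r′ *ℤ m ≡ + n *ℤ r →
               q ≡ k *ℤ q′ → s ≡ m *ℤ s′ →
               ∣ p *ℤ s - q *ℤ r ∣ ≡ 1 → ∣ p′ *ℤ s′ - q′ *ℤ r′ ∣ ≡ 1 → n ≡ ∣ k ∣ * ∣ m ∣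
scale-factor n p r p′ q′ r′ s′ k m p′k≡np r′m≡nr refl refl det det′ = begin
  n                              ≡⟨ ℕP.*-identityʳ n ⟨
  n * 1                          ≡⟨ cong (n *_) det ⟨
  n * ∣ D ∣                      ≡⟨ ℤP.abs-* (+ n) D ⟨
  ∣ + n *ℤ D ∣                   ≡⟨ cong ∣_∣ det-scale ⟨
  ∣ D′ *ℤ (k *ℤ m) ∣             ≡⟨ ℤP.abs-* D′ (k *ℤ m) ⟩
  ∣ D′ ∣ * ∣ k *ℤ m ∣             ≡⟨ cong (_* ∣ k *ℤ m ∣) det′ ⟩
  1 * ∣ k *ℤ m ∣                  ≡⟨ ℕP.*-identityˡ ∣ k *ℤ m ∣ ⟩
  ∣ k *ℤ m ∣                      ≡⟨ ℤP.abs-* k m ⟩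
  ∣ k ∣ * ∣ m ∣                    ∎
  where
  open ≡-Reasoning
  D  = p *ℤ (m *ℤ s′) - k *ℤ q′ *ℤ r
  D′ = p′ *ℤ s′ - q′ *ℤ r′
  expand : ∀ a b c d e f →
           (a *ℤ b - c *ℤ d) *ℤ (e *ℤ f) ≡ a *ℤ e *ℤ (f *ℤ b) - e *ℤ c *ℤ (d *ℤ f)
  expand = solve-∀
  collect : ∀ a b c d e f g →
            a *ℤ b *ℤ (c *ℤ d) - e *ℤ f *ℤ (a *ℤ g) ≡ a *ℤ (b *ℤ (c *ℤ d) - e *ℤ f *ℤ g)
  collect = solve-∀
  det-scale : D′ *ℤ (k *ℤ m) ≡ + n *ℤ D
  det-scale = begin
    D′ *ℤ (k *ℤ m)                                ≡⟨ expand p′ s′ q′ r′ k m ⟩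
    p′ *ℤ k *ℤ (m *ℤ s′) - k *ℤ q′ *ℤ (r′ *ℤ m)   ≡⟨ cong₂ (λ i j → i *ℤ (m *ℤ s′) - k *ℤ q′ *ℤ j)
                                                             p′k≡np r′m≡nr ⟩
    + n *ℤ p *ℤ (m *ℤ s′) - k *ℤ q′ *ℤ (+ n *ℤ r) ≡⟨ collect (+ n) p m s′ k q′ r ⟩
    + n *ℤ D                                      ∎

∣factor∣≥1 : ∀ k q′ {q} → q ≢ + 0 → q ≡ k *ℤ q′ → ∣ k ∣ ≥ 1
∣factor∣≥1 k q′ q≢0 q≡kq′ =
  ℕP.n≢0⇒n>0 (λ ∣k∣≡0 → q≢0 (trans q≡kq′ (cong (_*ℤ q′) (ℤP.∣i∣≡0⇒i≡0 {k} ∣k∣≡0))))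

FactoredNeighbours : ℕ → Point → Point → Set
FactoredNeighbours n A B =
  ∃ λ (n₁ : ℕ) → ∃ λ (n₂ : ℕ) → ∃ λ (a : ℤ) → ∃ λ (c₁ : ℤ) → ∃ λ (b : ℤ) → ∃ λ (d₁ : ℤ) →
    n₁ ≥ 1 × n₂ ≥ 1 × n ≡ n₁ * n₂ ×
    ReducedForm A a (+ n₁ *ℤ c₁) × ReducedForm B b (+ n₂ *ℤ d₁) ×
    ∣ a *ℤ + n₂ *ℤ d₁ - b *ℤ + n₁ *ℤ c₁ ∣ ≡ 1

det-factored : ∀ a b c d x y → a *ℤ (y *ℤ d) - x *ℤ c *ℤ b ≡ a *ℤ y *ℤ d - b *ℤ x *ℤ c
det-factored = solve-∀

factored : ∀ {n A B q s} n₁ n₂ c₁ d₁ p r → n₁ ≥ 1 → n₂ ≥ 1 → n ≡ n₁ * n₂ →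
           q ≡ + n₁ *ℤ c₁ → s ≡ + n₂ *ℤ d₁ →
           ReducedForm A p q → ReducedForm B r s → ∣ p *ℤ s - q *ℤ r ∣ ≡ 1 →
           FactoredNeighbours n A B
factored n₁ n₂ c₁ d₁ p r n₁≥1 n₂≥1 n≡n₁n₂ refl refl RA RB det =
  n₁ , n₂ , p , c₁ , r , d₁ , n₁≥1 , n₂≥1 , n≡n₁n₂ , RA , RB ,
  trans (cong ∣_∣ (sym (det-factored p r c₁ d₁ (+ n₁) (+ n₂)))) det

forward : ∀ n {A B} → n ≥ 1 → FareyNeighbours A B → ScaledFareyNeighbours n A B →
          FactoredNeighbours n A B
-- The denominator 0 of ∞ is divisible by anything, so all of n goes to that side.
forward n {∞} {B} n≥1 (p , q , r , s , RA@(_ , q≡0) , RB , det) _ =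
  factored {A = ∞} {B} n 1 (+ 0) s p r n≥1 (ℕ.s≤s ℕ.z≤n) (sym (ℕP.*-identityʳ n))
    (trans q≡0 (sym (ℤP.*-zeroʳ (+ n)))) (sym (ℤP.*-identityˡ s)) RA RB det
forward n {fin x} {∞} n≥1 (p , q , r , s , RA , RB@(_ , s≡0) , det) _ =
  factored {A = fin x} {∞} 1 n q (+ 0) p r (ℕ.s≤s ℕ.z≤n) n≥1 (sym (ℕP.*-identityˡ n))
    (sym (ℤP.*-identityˡ q)) (trans s≡0 (sym (ℤP.*-zeroʳ (+ n)))) RA RB det
forward n {fin x} {fin z} _
  (p , q , r , s , RA@(_ , repA@(q≢0 , _)) , RB@(_ , repB@(s≢0 , _)) , det)
  (p′ , q′ , r′ , s′ , RA′ , RB′ , det′) =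
  let k , q≡kq′ , p′k≡np = denominator-divides n {x} {p} {q} {p′} {q′} repA RA′
      m , s≡ms′ , r′m≡nr = denominator-divides n {z} {r} {s} {r′} {s′} repB RB′
      c₁ , kq′≡∣k∣c₁     = abs-factor k q′
      d₁ , ms′≡∣m∣d₁     = abs-factor m s′
  in factored {A = fin x} {fin z} ∣ k ∣ ∣ m ∣ c₁ d₁ p r
       (∣factor∣≥1 k q′ q≢0 q≡kq′) (∣factor∣≥1 m s′ s≢0 s≡ms′)
       (scale-factor n p r p′ q′ r′ s′ k m p′k≡np r′m≡nr q≡kq′ s≡ms′ det det′)
       (trans q≡kq′ kq′≡∣k∣c₁) (trans s≡ms′ ms′≡∣m∣d₁) RA RB det

backward : ∀ n {A B} → FactoredNeighbours n A B →
           FareyNeighbours A B × ScaledFareyNeighbours n A B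
backward _ {B = B}
  (n₁ , n₂ , a , c₁ , b , d₁ , n₁≥1 , n₂≥1 , refl , RA@(_ , repA) , RB@(_ , repB) , det) =
  (a , + n₁ *ℤ c₁ , b , + n₂ *ℤ d₁ , RA , RB ,
    trans (cong ∣_∣ (det-factored a b c₁ d₁ (+ n₁) (+ n₂))) det) ,
  (+ n₂ *ℤ a , c₁ , + n₁ *ℤ b , d₁ ,
    (proj₁ scaled-coprime , represents-unscale n₁ n₂ n₁≥1 repA) ,
    (proj₂ scaled-coprime ,
      subst (λ N → Represents (scale N B) (+ n₁ *ℤ b) d₁) (ℕP.*-comm n₂ n₁)
        (represents-unscale n₂ n₁ n₂≥1 repB)) ,
    scaled-det)
  where
  det-rescaled : ∀ a b c d x y → y *ℤ a *ℤ d - c *ℤ (x *ℤ b) ≡ a *ℤ y *ℤ d - b *ℤ x *ℤ c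
  det-rescaled = solve-∀
  scaled-det : ∣ + n₂ *ℤ a *ℤ d₁ - c₁ *ℤ (+ n₁ *ℤ b) ∣ ≡ 1
  scaled-det = trans (cong ∣_∣ (det-rescaled a b c₁ d₁ (+ n₁) (+ n₂))) det
  scaled-coprime : ℤC.Coprime (+ n₂ *ℤ a) c₁ × ℤC.Coprime (+ n₁ *ℤ b) d₁
  scaled-coprime = det-coprime (+ n₂ *ℤ a) c₁ (+ n₁ *ℤ b) d₁ scaled-det

mainTheorem10 : (n : ℕ) → n ≥ 1 → (A B : Point) →
    (FareyNeighbours A B × ScaledFareyNeighbours n A B) ⇔
    (∃ λ (n₁ : ℕ) → ∃ λ (n₂ : ℕ) → ∃ λ (a : ℤ) → ∃ λ (c₁ : ℤ) → ∃ λ (b : ℤ) → ∃ λ (d₁ : ℤ) →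
      n₁ ≥ 1 × n₂ ≥ 1 × n ≡ n₁ * n₂ ×
      ReducedForm A a (+ n₁ *ℤ c₁) × ReducedForm B b (+ n₂ *ℤ d₁) ×
      ∣ a *ℤ + n₂ *ℤ d₁ - b *ℤ + n₁ *ℤ c₁ ∣ ≡ 1)
mainTheorem10 n n≥1 A B =
  mk⇔ (λ (F , F′) → forward n n≥1 F F′) (backward n)
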